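{- For every $n\ge1$, the number of integer sequences $e=(e_1,\dots,e_n)$ with $0\le e_i<i$ for all $i$ having no indices $i<j<k$ with $e_i>e_j$ and $e_i>e_k$ equals the number of such sequences having no indices $i<j<k$ with $e_i\ge e_j$, $e_j\ne e_k$ and $e_i>e_k$. -}

module Defs where

open import Data.Nat using (ℕ; zero; suc; _<_; _>_; _≥_)
open import Data.Fin using (Fin; toℕ)
open import Data.Vec using (Vec; []; _∷_; lookup)
open import Data.List using (List; []; _∷_; length; filter; allFin; concatMap; map)
open import Data.Product using (∃-syntax; _×_)
open import Relation.Binary.PropositionalEquality using (_≢_)
open import Relation.Nullary using (¬_)
open import Relation.Unary using (Decidable)

-- Inversion sequences of length n, stored 0-indexed as a vector of naturals:
-- position i (0 ≤ i < n) holds e_i with e_i < i + 1, i.e. the paper's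
-- condition 0 ≤ e_{i+1} < i+1.
IsInvSeq : ∀ {n} → Vec ℕ n → Set
IsInvSeq {n} e = (i : Fin n) → lookup e i < suc (toℕ i)

Pattern1 : ∀ {n} → Vec ℕ n → Set
Pattern1 {n} e = ∃[ i ] ∃[ j ] ∃[ k ]
  (toℕ i < toℕ j × toℕ j < toℕ k × lookup e i > lookup e j × lookup e i > lookup e k)

Pattern2 : ∀ {n} → Vec ℕ n → Set
Pattern2 {n} e = ∃[ i ] ∃[ j ] ∃[ k ]
  (toℕ i < toℕ j × toℕ j < toℕ k × lookup e i ≥ lookup e j × lookup e j ≢ lookup e k × lookup e i > lookup e k)

vecsBelow : (b n : ℕ) → List (Vec ℕ n)
vecsBelow b zero = [] ∷ []
vecsBelow b (suc n) =
  concatMap (λ x → map (x ∷_) (vecsBelow b n)) (map toℕ (allFin b))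

-- Number of length-n vectors (entries < n, hence all inversion sequences
-- counted exactly once) satisfying the decidable predicate P.
count : (n : ℕ) {P : Vec ℕ n → Set} → Decidable P → ℕ
count n P? = length (filter P? (vecsBelow n n))

-- Call an entry e_k of an inversion sequence raisable if it lies strictly below
-- M_k = max(e_1, …, e_{k-1}) and the value e_k occurs again later, and lowerable if
-- e_k = M_k and some later entry is smaller. Raising every raisable entry to M_k maps
-- the sequences avoiding pattern 2 to those avoiding pattern 1; lowering every lowerable
-- entry to a smaller later entry (unique in the absence of pattern 1) is its inverse.
-- Neither map changes any prefix maximum M_k, and an occurrence of either pattern can
-- always be chosen with e_i = M_j, so both patterns and both inverse laws can be checked
-- one position at a time against the fixed prefix maxima.

module Submission where

open import Defs
open import Data.Nat using (ℕ; zero; suc; _≤_; _<_; _>_; _≥_; _⊔_; z≤n; s≤s; _≟_; _<?_)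
open import Data.Nat.Properties
open import Data.Fin using (Fin; toℕ; fromℕ<)
import Data.Fin as Fin
open import Data.Fin.Properties using (toℕ<n; toℕ-fromℕ<; toℕ-injective)
open import Data.Vec using (Vec; []; _∷_; lookup)
import Data.Vec.Properties as Vec
open import Data.List using (length; filter; allFin; map)
open import Data.List.Properties using (length-map; map-∘; map-id-local)
open import Data.List.Membership.Propositional using (_∈_)
open import Data.List.Membership.Propositional.Properties
  using (∈-map⁺; ∈-map⁻; ∈-concat⁺′; ∈-allFin; ∈-filter⁺; ∈-filter⁻)
open import Data.List.Membership.Propositional.Properties.WithK using (unique∧set⇒bag)
open import Data.List.Relation.Unary.Any using (here)
import Data.List.Relation.Unary.All as All
import Data.List.Relation.Unary.All.Properties as All
import Data.List.Relation.Unary.AllPairs as AllPairs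
import Data.List.Relation.Unary.AllPairs.Properties as AllPairs
open import Data.List.Relation.Unary.Unique.Propositional using (Unique)
import Data.List.Relation.Unary.Unique.Propositional.Properties as Unique
open import Data.List.Relation.Binary.Disjoint.Propositional using (Disjoint)
open import Data.List.Relation.Binary.BagAndSetEquality using (∼bag⇒↭)
open import Data.List.Relation.Binary.Permutation.Propositional.Properties using (↭-length)
open import Data.Product using (Σ; ∃-syntax; _×_; _,_; proj₁; proj₂)
open import Data.Sum using (_⊎_; inj₁; inj₂)
open import Data.Empty using (⊥)
open import Function.Base using (_∘_)
open import Function.Bundles using (_⇔_; mk⇔)
open import Relation.Nullary using (¬_; Dec; yes; no; contradiction)
open import Relation.Nullary.Decidable using (_×-dec_)
open import Relation.Unary using (Pred; Decidable; _⊆_)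
open import Relation.Binary.Definitions using (tri<; tri≈; tri>)
open import Relation.Binary.PropositionalEquality
  using (_≡_; _≢_; refl; sym; trans; cong; cong₂; subst; subst₂; module ≡-Reasoning)

module _ {a p q} {A : Set a} {P : Pred A p} {Q : Pred A q}
         (P? : Decidable P) (Q? : Decidable Q) where

  length-filter-≡ : ∀ {xs} → Unique xs → P ⊆ (_∈ xs) → Q ⊆ (_∈ xs) →
    (f g : A → A) → (∀ {x} → Q x → P (f x)) → (∀ {x} → P x → Q (g x)) →
    (∀ {x} → Q x → g (f x) ≡ x) → (∀ {x} → P x → f (g x) ≡ x) →
    length (filter P? xs) ≡ length (filter Q? xs)
  length-filter-≡ {xs} xs! P⊆xs Q⊆xs f g f-QP g-PQ g∘f f∘g = begin
    length (filter P? xs)   ≡⟨ ↭-length (∼bag⇒↭ (unique∧set⇒bag Pxs! fQxs! same-members)) ⟩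
    length (map f Qxs)      ≡⟨ length-map f Qxs ⟩
    length Qxs              ∎
    where
    open ≡-Reasoning
    Qxs = filter Q? xs
    Pxs! : Unique (filter P? xs)
    Pxs! = Unique.filter⁺ P? xs!
    -- f is injective on Qxs since g undoes it there.
    fQxs! : Unique (map f Qxs)
    fQxs! = Unique.map⁻ (subst Unique (sym g∘f∘Qxs) (Unique.filter⁺ Q? xs!))
      where
      g∘f∘Qxs : map g (map f Qxs) ≡ Qxs
      g∘f∘Qxs = trans (sym (map-∘ Qxs)) (map-id-local (All.map g∘f (All.all-filter Q? xs)))
    same-members : ∀ {x} → (x ∈ filter P? xs) ⇔ (x ∈ map f Qxs)
    same-members = mk⇔ from to
      where
      from : ∀ {x} → x ∈ filter P? xs → x ∈ map f Qxs
      from {x} x∈ with Px ← proj₂ (∈-filter⁻ P? {xs = xs} x∈) =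
        subst (_∈ map f Qxs) (f∘g Px) (∈-map⁺ f (∈-filter⁺ Q? (Q⊆xs (g-PQ Px)) (g-PQ Px)))
      to : ∀ {x} → x ∈ map f Qxs → x ∈ filter P? xs
      to x∈ with ∈-map⁻ f x∈
      ... | y , y∈ , refl with Qy ← proj₂ (∈-filter⁻ Q? {xs = xs} y∈) =
        ∈-filter⁺ P? (P⊆xs (f-QP Qy)) (f-QP Qy)

∈-vecsBelow : ∀ {b m} (v : Vec ℕ m) → (∀ i → lookup v i < b) → v ∈ vecsBelow b m
∈-vecsBelow         []      _   = here refl
∈-vecsBelow {b} {suc m} (x ∷ v) v<b =
  ∈-concat⁺′ (∈-map⁺ (x ∷_) (∈-vecsBelow v (v<b ∘ Fin.suc)))
             (∈-map⁺ (λ y → map (y ∷_) (vecsBelow b m)) x∈)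
  where
  x∈ : x ∈ map toℕ (allFin b)
  x∈ = subst (_∈ map toℕ (allFin b)) (toℕ-fromℕ< (v<b Fin.zero)) (∈-map⁺ toℕ (∈-allFin _))

vecsBelow-unique : ∀ b m → Unique (vecsBelow b m)
vecsBelow-unique b zero    = All.[] AllPairs.∷ AllPairs.[]
vecsBelow-unique b (suc m) =
  Unique.concat⁺ (All.map⁺ (All.universal (λ _ → Unique.map⁺ Vec.∷-injectiveʳ vs!) _))
                 (AllPairs.map⁺ (AllPairs.map disjoint (Unique.map⁺ toℕ-injective (Unique.allFin⁺ b))))
  where
  vs! = vecsBelow-unique b m
  disjoint : ∀ {x y} → x ≢ y → Disjoint (map (x ∷_) (vecsBelow b m)) (map (y ∷_) (vecsBelow b m))
  disjoint x≢y (v∈x , v∈y) with ∈-map⁻ _ v∈x | ∈-map⁻ _ v∈y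
  ... | _ , _ , refl | _ , _ , v≡y∷w = x≢y (Vec.∷-injectiveˡ v≡y∷w)

lastWitness : ∀ {p} {P : Pred ℕ p} → Decidable P → ∀ {v} → ∃[ l ] (l < v × P l) →
  ∃[ l ] (l < v × P l × (∀ {m} → l < m → m < v → ¬ P m))
lastWitness {P = P} P? {suc v} (l , l<1+v , Pl) with P? v | m<1+n⇒m<n∨m≡n l<1+v
... | yes Pv | _        = v , ≤-refl , Pv , λ v<m m<1+v → contradiction (≤-pred m<1+v) (<⇒≱ v<m)
... | no ¬Pv | inj₂ refl = contradiction Pl ¬Pv
... | no ¬Pv | inj₁ l<v with lastWitness P? (l , l<v , Pl)
...   | l′ , l′<v , Pl′ , none-after = l′ , m<n⇒m<1+n l′<v , Pl′ , none-after′
  where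
  none-after′ : ∀ {m} → l′ < m → m < suc v → ¬ P m
  none-after′ l′<m m<1+v with m<1+n⇒m<n∨m≡n m<1+v
  ... | inj₁ m<v  = none-after l′<m m<v
  ... | inj₂ refl = ¬Pv

subst₃ : ∀ {a b c t} {A : Set a} {B : Set b} {C : Set c} (T : A → B → C → Set t) →
  ∀ {x x′ y y′ z z′} → x ≡ x′ → y ≡ y′ → z ≡ z′ → T x y z → T x′ y′ z′
subst₃ T refl refl refl t = t

⊔-absorbs : ∀ {m x y} → x ≤ m → y ≤ m → m ⊔ x ≡ m ⊔ y
⊔-absorbs x≤m y≤m = trans (m≥n⇒m⊔n≡m x≤m) (sym (m≥n⇒m⊔n≡m y≤m))

maxBefore : (ℕ → ℕ) → ℕ → ℕ
maxBefore E zero    = 0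
maxBefore E (suc k) = maxBefore E k ⊔ E k

module _ (E : ℕ → ℕ) where

  ≤-maxBefore : ∀ {j k} → j < k → E j ≤ maxBefore E k
  ≤-maxBefore {j} {suc k} j<1+k with m<1+n⇒m<n∨m≡n j<1+k
  ... | inj₁ j<k  = ≤-trans (≤-maxBefore j<k) (m≤m⊔n (maxBefore E k) (E k))
  ... | inj₂ refl = m≤n⊔m (maxBefore E k) (E k)

  maxBefore-mono : ∀ {j k} → j ≤ k → maxBefore E j ≤ maxBefore E k
  maxBefore-mono {zero}          _           = z≤n
  maxBefore-mono {suc j} {suc k} (s≤s j≤k) =
    ⊔-lub (≤-trans (maxBefore-mono j≤k) (m≤m⊔n (maxBefore E k) (E k))) (≤-maxBefore (s≤s j≤k))

  maxBefore-attained : ∀ {x k} → x < maxBefore E k → ∃[ h ] (h < k × E h ≡ maxBefore E k)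
  maxBefore-attained {x} {suc k} x<max with ⊔-sel (maxBefore E k) (E k)
  ... | inj₂ max≡Ek = k , ≤-refl , sym max≡Ek
  ... | inj₁ max≡prev with maxBefore-attained (subst (x <_) max≡prev x<max)
  ...   | h , h<k , Eh≡prev = h , m<n⇒m<1+n h<k , trans Eh≡prev (sym max≡prev)

  maxBefore-≤ : ∀ {k} → (∀ h → h < k → E h ≤ h) → maxBefore E k ≤ k
  maxBefore-≤ {zero}  _     = z≤n
  maxBefore-≤ {suc k} E≤id = ⊔-lub (m≤n⇒m≤1+n (maxBefore-≤ (λ h h<k → E≤id h (m<n⇒m<1+n h<k))))
                                   (m≤n⇒m≤1+n (E≤id k ≤-refl))

maxBefore-cong : ∀ {E E′ k} →
  (∀ h → h < k → maxBefore E h ⊔ E′ h ≡ maxBefore E h ⊔ E h) → maxBefore E′ k ≡ maxBefore E k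
maxBefore-cong         {k = zero}  _  = refl
maxBefore-cong {E} {E′} {suc k} eq = begin
  maxBefore E′ k ⊔ E′ k  ≡⟨ cong (_⊔ E′ k) (maxBefore-cong (λ h h<k → eq h (m<n⇒m<1+n h<k))) ⟩
  maxBefore E k ⊔ E′ k   ≡⟨ eq k ≤-refl ⟩
  maxBefore E k ⊔ E k    ∎
  where open ≡-Reasoning

lookupℕ : ∀ {n} → Vec ℕ n → ℕ → ℕ
lookupℕ []      _       = 0
lookupℕ (x ∷ v) zero    = x
lookupℕ (x ∷ v) (suc k) = lookupℕ v k

lookup≡lookupℕ : ∀ {n} (v : Vec ℕ n) (i : Fin n) → lookup v i ≡ lookupℕ v (toℕ i)
lookup≡lookupℕ (x ∷ v) Fin.zero    = refl
lookup≡lookupℕ (x ∷ v) (Fin.suc i) = lookup≡lookupℕ v i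

tabulateℕ : (n : ℕ) → (ℕ → ℕ) → Vec ℕ n
tabulateℕ zero    h = []
tabulateℕ (suc n) h = h 0 ∷ tabulateℕ n (h ∘ suc)

lookupℕ-tabulateℕ : ∀ n h {k} → k < n → lookupℕ (tabulateℕ n h) k ≡ h k
lookupℕ-tabulateℕ (suc n) h {zero}  _         = refl
lookupℕ-tabulateℕ (suc n) h {suc k} (s≤s k<n) = lookupℕ-tabulateℕ n (h ∘ suc) k<n

tabulateℕ-lookupℕ : ∀ {n} (v : Vec ℕ n) h →
  (∀ k → k < n → h k ≡ lookupℕ v k) → tabulateℕ n h ≡ v
tabulateℕ-lookupℕ []      h _    = refl
tabulateℕ-lookupℕ (x ∷ v) h h≗v =
  cong₂ _∷_ (h≗v 0 (s≤s z≤n)) (tabulateℕ-lookupℕ v (h ∘ suc) (λ k k<n → h≗v (suc k) (s≤s k<n)))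

toℕ-onto : ∀ {n k} → k < n → Σ (Fin n) (λ i → toℕ i ≡ k)
toℕ-onto k<n = fromℕ< k<n , toℕ-fromℕ< k<n

Contains : (ℕ → ℕ → ℕ → Set) → ∀ {n} → Vec ℕ n → Set
Contains T e = ∃[ i ] ∃[ j ] ∃[ k ]
  (toℕ i < toℕ j × toℕ j < toℕ k × T (lookup e i) (lookup e j) (lookup e k))

Pat₁ Pat₂ : ℕ → ℕ → ℕ → Set
Pat₁ a b c = a > b × a > c
Pat₂ a b c = a ≥ b × b ≢ c × a > c

UpwardClosed : (ℕ → ℕ → ℕ → Set) → Set
UpwardClosed T = ∀ {a a′ b c} → a ≤ a′ → T a b c → T a′ b c

Pat₁-upward : UpwardClosed Pat₁
Pat₁-upward a≤a′ (b<a , c<a) = <-≤-trans b<a a≤a′ , <-≤-trans c<a a≤a′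

Pat₂-upward : UpwardClosed Pat₂
Pat₂-upward a≤a′ (b≤a , b≢c , c<a) = ≤-trans b≤a a≤a′ , b≢c , <-≤-trans c<a a≤a′

module _ (n : ℕ) where

  IsInvSeqℕ : (ℕ → ℕ) → Set
  IsInvSeqℕ E = ∀ k → k < n → E k ≤ k

  Containsℕ : (ℕ → ℕ → ℕ → Set) → (ℕ → ℕ) → Set
  Containsℕ T E = ∃[ i ] ∃[ j ] ∃[ k ] (i < j × j < k × k < n × T (E i) (E j) (E k))

  Containsᴹ : (ℕ → ℕ → ℕ → Set) → (ℕ → ℕ) → Set
  Containsᴹ T E = ∃[ j ] ∃[ k ] (j < k × k < n × T (maxBefore E j) (E j) (E k))

  Containsℕ⇒Containsᴹ : ∀ {T E} → UpwardClosed T → Containsℕ T E → Containsᴹ T E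
  Containsℕ⇒Containsᴹ {E = E} T↑ (i , j , k , i<j , j<k , k<n , t) =
    j , k , j<k , k<n , T↑ (≤-maxBefore E i<j) t

  Containsᴹ⇒Containsℕ : ∀ {T E} → (∀ {a b c} → T a b c → c < a) → Containsᴹ T E → Containsℕ T E
  Containsᴹ⇒Containsℕ {T} {E} c<a (j , k , j<k , k<n , t) with maxBefore-attained E (c<a t)
  ... | i , i<j , Ei≡max = i , j , k , i<j , j<k , k<n , subst (λ a → T a (E j) (E k)) (sym Ei≡max) t

  IsInvSeq⇒IsInvSeqℕ : ∀ {e : Vec ℕ n} → IsInvSeq e → IsInvSeqℕ (lookupℕ e)
  IsInvSeq⇒IsInvSeqℕ {e} inv k k<n with toℕ-onto k<n
  ... | i , refl = ≤-pred (subst (_< suc (toℕ i)) (lookup≡lookupℕ e i) (inv i))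

  IsInvSeqℕ⇒IsInvSeq : ∀ {e : Vec ℕ n} → IsInvSeqℕ (lookupℕ e) → IsInvSeq e
  IsInvSeqℕ⇒IsInvSeq {e} inv i =
    s≤s (subst (_≤ toℕ i) (sym (lookup≡lookupℕ e i)) (inv (toℕ i) (toℕ<n i)))

  Contains⇒Containsℕ : ∀ {T} {e : Vec ℕ n} → Contains T e → Containsℕ T (lookupℕ e)
  Contains⇒Containsℕ {T} {e} (i , j , k , i<j , j<k , t) =
    toℕ i , toℕ j , toℕ k , i<j , j<k , toℕ<n k ,
    subst₃ T (lookup≡lookupℕ e i) (lookup≡lookupℕ e j) (lookup≡lookupℕ e k) t

  Containsℕ⇒Contains : ∀ {T} {e : Vec ℕ n} → Containsℕ T (lookupℕ e) → Contains T e
  Containsℕ⇒Contains {T} {e} (i , j , k , i<j , j<k , k<n , t)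
    with toℕ-onto (<-trans i<j (<-trans j<k k<n)) | toℕ-onto (<-trans j<k k<n) | toℕ-onto k<n
  ... | i′ , refl | j′ , refl | k′ , refl =
    i′ , j′ , k′ , i<j , j<k ,
    subst₃ T (sym (lookup≡lookupℕ e i′)) (sym (lookup≡lookupℕ e j′)) (sym (lookup≡lookupℕ e k′)) t

  RepeatsLater DropsLater : (ℕ → ℕ) → ℕ → Set
  RepeatsLater E k = ∃[ l ] (l < n × (k < l × E l ≡ E k))
  DropsLater   E k = ∃[ l ] (l < n × (k < l × E l < E k))

  Raisable Lowerable : (ℕ → ℕ) → ℕ → Set
  Raisable  E k = E k < maxBefore E k × RepeatsLater E k
  Lowerable E k = E k ≡ maxBefore E k × DropsLater E k

  raisable? : ∀ E k → Dec (Raisable E k)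
  raisable? E k = (E k <? maxBefore E k) ×-dec anyUpTo? (λ l → (k <? l) ×-dec (E l ≟ E k)) n

  lowerable? : ∀ E k → Dec (Lowerable E k)
  lowerable? E k = (E k ≟ maxBefore E k) ×-dec anyUpTo? (λ l → (k <? l) ×-dec (E l <? E k)) n

  raise lower : (ℕ → ℕ) → ℕ → ℕ
  raise E k with raisable? E k
  ... | yes _ = maxBefore E k
  ... | no  _ = E k
  lower E k with lowerable? E k
  ... | yes (_ , l , _) = E l
  ... | no  _           = E k

  Raise Lower : (ℕ → ℕ) → (ℕ → ℕ) → Set
  Raise E E′ = ∀ k → k < n → E′ k ≡ raise E k
  Lower E E′ = ∀ k → k < n → E′ k ≡ lower E k

  raised-or-kept : ∀ {E E′} → Raise E E′ → ∀ {k} → k < n →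
    (Raisable E k × E′ k ≡ maxBefore E k) ⊎ (¬ Raisable E k × E′ k ≡ E k)
  raised-or-kept {E} E′≗ {k} k<n with raisable? E k | E′≗ k k<n
  ... | yes r  | eq = inj₁ (r , eq)
  ... | no ¬r | eq = inj₂ (¬r , eq)

  lowered-or-kept : ∀ {E E′} → Lower E E′ → ∀ {k} → k < n →
    (E k ≡ maxBefore E k × ∃[ r ] (r < n × k < r × E r < E k × E′ k ≡ E r)) ⊎
    (¬ Lowerable E k × E′ k ≡ E k)
  lowered-or-kept {E} E′≗ {k} k<n with lowerable? E k | E′≗ k k<n
  ... | yes (Ek≡max , r , r<n , k<r , Er<Ek) | eq = inj₁ (Ek≡max , r , r<n , k<r , Er<Ek , eq)
  ... | no ¬l                                 | eq = inj₂ (¬l , eq)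

  Raise-maxBefore : ∀ {E E′} → Raise E E′ → ∀ {k} → k ≤ n → maxBefore E′ k ≡ maxBefore E k
  Raise-maxBefore {E} {E′} E′≗ k≤n = maxBefore-cong same-max
    where
    same-max : ∀ h → h < _ → maxBefore E h ⊔ E′ h ≡ maxBefore E h ⊔ E h
    same-max h h<k with raised-or-kept {E} E′≗ (<-≤-trans h<k k≤n)
    ... | inj₁ ((Eh<max , _) , E′h≡max) = ⊔-absorbs (≤-reflexive E′h≡max) (<⇒≤ Eh<max)
    ... | inj₂ (_ , E′h≡Eh)             = cong (maxBefore E h ⊔_) E′h≡Eh

  Lower-maxBefore : ∀ {E E′} → Lower E E′ → ∀ {k} → k ≤ n → maxBefore E′ k ≡ maxBefore E k
  Lower-maxBefore {E} {E′} E′≗ k≤n = maxBefore-cong same-max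
    where
    same-max : ∀ h → h < _ → maxBefore E h ⊔ E′ h ≡ maxBefore E h ⊔ E h
    same-max h h<k with lowered-or-kept {E} E′≗ (<-≤-trans h<k k≤n)
    ... | inj₁ (Eh≡max , r , _ , _ , Er<Eh , E′h≡Er) =
      ⊔-absorbs (≤-trans (≤-reflexive E′h≡Er) (<⇒≤ (subst (E r <_) Eh≡max Er<Eh)))
                (≤-reflexive Eh≡max)
    ... | inj₂ (_ , E′h≡Eh) = cong (maxBefore E h ⊔_) E′h≡Eh

  Raise-IsInvSeqℕ : ∀ {E E′} → Raise E E′ → IsInvSeqℕ E → IsInvSeqℕ E′
  Raise-IsInvSeqℕ {E} E′≗ inv k k<n with raised-or-kept {E} E′≗ k<n
  ... | inj₁ (_ , E′k≡max) =
    subst (_≤ k) (sym E′k≡max) (maxBefore-≤ E (λ h h<k → inv h (<-trans h<k k<n)))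
  ... | inj₂ (_ , E′k≡Ek)  = subst (_≤ k) (sym E′k≡Ek) (inv k k<n)

  Lower-IsInvSeqℕ : ∀ {E E′} → Lower E E′ → IsInvSeqℕ E → IsInvSeqℕ E′
  Lower-IsInvSeqℕ {E} E′≗ inv k k<n with lowered-or-kept {E} E′≗ k<n
  ... | inj₁ (_ , r , _ , _ , Er<Ek , E′k≡Er) =
    subst (_≤ k) (sym E′k≡Er) (≤-trans (<⇒≤ Er<Ek) (inv k k<n))
  ... | inj₂ (_ , E′k≡Ek) = subst (_≤ k) (sym E′k≡Ek) (inv k k<n)

  Raise-≥ : ∀ {E E′} → Raise E E′ → ∀ {k} → k < n → E k ≤ E′ k
  Raise-≥ {E} E′≗ k<n with raised-or-kept {E} E′≗ k<n
  ... | inj₁ ((Ek<max , _) , E′k≡max) = subst (_ ≤_) (sym E′k≡max) (<⇒≤ Ek<max)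
  ... | inj₂ (_ , E′k≡Ek)             = ≤-reflexive (sym E′k≡Ek)

  Raise-keeps-below-maxBefore : ∀ {E E′} → Raise E E′ → ∀ {k r} → k ≤ r → r < n →
    E′ r < maxBefore E k → ¬ Raisable E r × E′ r ≡ E r
  Raise-keeps-below-maxBefore {E} E′≗ k≤r r<n E′r<max with raised-or-kept {E} E′≗ r<n
  ... | inj₁ (_ , E′r≡max) =
    contradiction (subst (_< _) E′r≡max E′r<max) (≤⇒≯ (maxBefore-mono E k≤r))
  ... | inj₂ kept          = kept

  Lower-origin : ∀ {E E′} → Lower E E′ → ∀ {k} → k < n → ∃[ q ] (q < n × k ≤ q × E′ k ≡ E q)
  Lower-origin {E} E′≗ {k} k<n with lowered-or-kept {E} E′≗ k<n
  ... | inj₁ (_ , r , r<n , k<r , _ , E′k≡Er) = r , r<n , <⇒≤ k<r , E′k≡Er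
  ... | inj₂ (_ , E′k≡Ek)                     = k , k<n , ≤-refl , E′k≡Ek

  lastRepeat : ∀ {E k} → RepeatsLater E k → ∃[ l ] (l < n × k < l × E l ≡ E k × ¬ RepeatsLater E l)
  lastRepeat {E} {k} rep with lastWitness (λ l → (k <? l) ×-dec (E l ≟ E k)) rep
  ... | l , l<n , (k<l , El≡Ek) , none-after =
    l , l<n , k<l , El≡Ek ,
    λ (m , m<n , l<m , Em≡El) → none-after l<m m<n (<-trans k<l l<m , trans Em≡El El≡Ek)

  below-unique : ∀ {E} → ¬ Containsᴹ Pat₁ E → ∀ {i p q} → i < p → i < q → p < n → q < n →
    E p < E i → E q < E i → p ≡ q
  below-unique {E} no₁ {i} {p} {q} i<p i<q p<n q<n Ep<Ei Eq<Ei with <-cmp p q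
  ... | tri< p<q _ _ = contradiction (p , q , p<q , q<n , Pat₁-upward (≤-maxBefore E i<p) (Ep<Ei , Eq<Ei)) no₁
  ... | tri≈ _ p≡q _ = p≡q
  ... | tri> _ _ q<p = contradiction (q , p , q<p , p<n , Pat₁-upward (≤-maxBefore E i<q) (Eq<Ei , Ep<Ei)) no₁

  below-max-equal : ∀ {E} → ¬ Containsᴹ Pat₂ E → ∀ {k r} → k < r → r < n →
    E k ≤ maxBefore E k → E r < maxBefore E k → E r ≡ E k
  below-max-equal {E} no₂ {k} {r} k<r r<n Ek≤max Er<max with E r ≟ E k
  ... | yes Er≡Ek = Er≡Ek
  ... | no  Er≢Ek = contradiction (k , r , k<r , r<n , Ek≤max , Er≢Ek ∘ sym , Er<max) no₂

  Raise-keeps-unrepeated : ∀ {E E′} → Raise E E′ → ∀ {l} → l < n → ¬ RepeatsLater E l → E′ l ≡ E l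
  Raise-keeps-unrepeated {E} E′≗ l<n ¬rep with raised-or-kept {E} E′≗ l<n
  ... | inj₁ ((_ , rep) , _) = contradiction rep ¬rep
  ... | inj₂ (_ , E′l≡El)    = E′l≡El

  Lower-keeps-later-smaller : ∀ {E E′} → Lower E E′ → ∀ {k r} → k < r → r < n →
    E r < E k → E′ r ≡ E r
  Lower-keeps-later-smaller {E} E′≗ k<r r<n Er<Ek with lowered-or-kept {E} E′≗ r<n
  ... | inj₁ (Er≡max , _)  = contradiction (subst (_ ≤_) (sym Er≡max) (≤-maxBefore E k<r)) (<⇒≱ Er<Ek)
  ... | inj₂ (_ , E′r≡Er) = E′r≡Er

  Raise-avoids₁ : ∀ {E E′} → ¬ Containsᴹ Pat₂ E → Raise E E′ → ¬ Containsᴹ Pat₁ E′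
  Raise-avoids₁ {E} {E′} no₂ E′≗ (j , k , j<k , k<n , E′j<max′ , E′k<max′) =
    no₂ (j , k , j<k , k<n , <⇒≤ Ej<max , Ej≢Ek , Ek<max)
    where
    max′≡max : maxBefore E′ j ≡ maxBefore E j
    max′≡max = Raise-maxBefore {E} E′≗ (<⇒≤ (<-trans j<k k<n))
    keptʲ = Raise-keeps-below-maxBefore {E} E′≗ ≤-refl (<-trans j<k k<n)
              (subst (E′ j <_) max′≡max E′j<max′)
    keptᵏ = Raise-keeps-below-maxBefore {E} E′≗ (<⇒≤ j<k) k<n
              (subst (E′ k <_) max′≡max E′k<max′)
    Ej<max : E j < maxBefore E j
    Ej<max = subst₂ _<_ (proj₂ keptʲ) max′≡max E′j<max′
    Ek<max : E k < maxBefore E j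
    Ek<max = subst₂ _<_ (proj₂ keptᵏ) max′≡max E′k<max′
    Ej≢Ek : E j ≢ E k
    Ej≢Ek Ej≡Ek = proj₁ keptʲ (Ej<max , k , k<n , j<k , sym Ej≡Ek)

  Lower-avoids₂ : ∀ {E E′} → ¬ Containsᴹ Pat₁ E → Lower E E′ → ¬ Containsᴹ Pat₂ E′
  Lower-avoids₂ {E} {E′} no₁ E′≗ (j , k , j<k , k<n , E′j≤max′ , E′j≢E′k , E′k<max′)
    with Lower-origin {E} E′≗ k<n
  ... | q , q<n , k≤q , E′k≡Eq = absurd
    where
    j<q = <-≤-trans j<k k≤q
    max′≡max : maxBefore E′ j ≡ maxBefore E j
    max′≡max = Lower-maxBefore {E} E′≗ (<⇒≤ (<-trans j<k k<n))
    Eq<max : E q < maxBefore E j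
    Eq<max = subst₂ _<_ E′k≡Eq max′≡max E′k<max′
    absurd : ⊥
    absurd with lowered-or-kept {E} E′≗ (<-trans j<k k<n)
    ... | inj₁ (Ej≡max , r , r<n , j<r , Er<Ej , E′j≡Er) =
      E′j≢E′k (trans E′j≡Er (trans (cong E r≡q) (sym E′k≡Eq)))
      where r≡q = below-unique no₁ j<r j<q r<n q<n Er<Ej (subst (E q <_) (sym Ej≡max) Eq<max)
    ... | inj₂ (¬lowerable , E′j≡Ej) with m≤n⇒m<n∨m≡n (subst₂ _≤_ E′j≡Ej max′≡max E′j≤max′)
    ...   | inj₁ Ej<max = no₁ (j , q , j<q , q<n , Ej<max , Eq<max)
    ...   | inj₂ Ej≡max = ¬lowerable (Ej≡max , q , q<n , j<q , subst (E q <_) (sym Ej≡max) Eq<max)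

  Lower∘Raise : ∀ {E E′ E″} → ¬ Containsᴹ Pat₂ E → Raise E E′ → Lower E′ E″ →
    ∀ k → k < n → E″ k ≡ E k
  Lower∘Raise {E} {E′} {E″} no₂ E′≗ E″≗ k k<n with lowered-or-kept {E′} E″≗ k<n
  ... | inj₁ (E′k≡max′ , r , r<n , k<r , E′r<E′k , E″k≡E′r) =
    trans E″k≡E′r (trans E′r≡Er (below-max-equal no₂ k<r r<n Ek≤max Er<max))
    where
    E′k≡max : E′ k ≡ maxBefore E k
    E′k≡max = trans E′k≡max′ (Raise-maxBefore {E} E′≗ (<⇒≤ k<n))
    E′r<max = subst (E′ r <_) E′k≡max E′r<E′k
    E′r≡Er = proj₂ (Raise-keeps-below-maxBefore {E} E′≗ (<⇒≤ k<r) r<n E′r<max)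
    Er<max = subst (_< _) E′r≡Er E′r<max
    Ek≤max = subst (E k ≤_) E′k≡max (Raise-≥ {E} E′≗ k<n)
  ... | inj₂ (¬lowerable , E″k≡E′k) with raised-or-kept {E} E′≗ k<n
  ...   | inj₂ (_ , E′k≡Ek) = trans E″k≡E′k E′k≡Ek
  ...   | inj₁ ((Ek<max , rep) , E′k≡max) with lastRepeat rep
  ...     | l , l<n , k<l , El≡Ek , ¬repˡ = contradiction lowerable ¬lowerable
    where
    -- The last repetition of E k is not raised, so it lies below the raised entry.
    lowerable : Lowerable E′ k
    lowerable = trans E′k≡max (sym (Raise-maxBefore {E} E′≗ (<⇒≤ k<n))) , l , l<n , k<l ,
      subst₂ _<_ (sym (trans (Raise-keeps-unrepeated {E} E′≗ l<n ¬repˡ) El≡Ek)) (sym E′k≡max) Ek<max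

  Raise∘Lower : ∀ {E E′ E″} → ¬ Containsᴹ Pat₁ E → Lower E E′ → Raise E′ E″ →
    ∀ k → k < n → E″ k ≡ E k
  Raise∘Lower {E} {E′} {E″} no₁ E′≗ E″≗ k k<n with lowered-or-kept {E} E′≗ k<n
  ... | inj₁ (Ek≡max , r , r<n , k<r , Er<Ek , E′k≡Er) with raised-or-kept {E′} E″≗ k<n
  ...   | inj₁ (_ , E″k≡max′) = trans E″k≡max′ (trans max′≡max (sym Ek≡max))
    where max′≡max = Lower-maxBefore {E} E′≗ (<⇒≤ k<n)
  ...   | inj₂ (¬raisable , _) = contradiction raisable ¬raisable
    where
    raisable : Raisable E′ k
    raisable = subst₂ _<_ (sym E′k≡Er) (trans Ek≡max (sym (Lower-maxBefore {E} E′≗ (<⇒≤ k<n)))) Er<Ek ,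
      r , r<n , k<r , trans (Lower-keeps-later-smaller {E} E′≗ k<r r<n Er<Ek) (sym E′k≡Er)
  Raise∘Lower {E} {E′} {E″} no₁ E′≗ E″≗ k k<n | inj₂ (_ , E′k≡Ek)
    with raised-or-kept {E′} E″≗ k<n
  ... | inj₂ (_ , E″k≡E′k) = trans E″k≡E′k E′k≡Ek
  ... | inj₁ ((E′k<max′ , l , l<n , k<l , E′l≡E′k) , _) with Lower-origin {E} E′≗ l<n
  ...   | q , q<n , l≤q , E′l≡Eq = contradiction (k , q , <-≤-trans k<l l≤q , q<n , Ek<max , Eq<max) no₁
    where
    Ek<max : E k < maxBefore E k
    Ek<max = subst₂ _<_ E′k≡Ek (Lower-maxBefore {E} E′≗ (<⇒≤ k<n)) E′k<max′
    Eq<max : E q < maxBefore E k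
    Eq<max = subst (_< maxBefore E k) (trans (sym E′k≡Ek) (trans (sym E′l≡E′k) E′l≡Eq)) Ek<max

  IsInvSeq-bounded : ∀ {e : Vec ℕ n} → IsInvSeq e → ∀ i → lookup e i < n
  IsInvSeq-bounded inv i = <-≤-trans (inv i) (toℕ<n i)

  Avoidsᴹ⇒Avoids : ∀ T {e : Vec ℕ n} → UpwardClosed T → ¬ Containsᴹ T (lookupℕ e) → ¬ Contains T e
  Avoidsᴹ⇒Avoids T {e} T↑ avoids = avoids ∘ Containsℕ⇒Containsᴹ {T} T↑ ∘ Contains⇒Containsℕ {T} {e}

  Avoids⇒Avoidsᴹ : ∀ T {e : Vec ℕ n} → (∀ {a b c} → T a b c → c < a) →
    ¬ Contains T e → ¬ Containsᴹ T (lookupℕ e)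
  Avoids⇒Avoidsᴹ T {e} c<a avoids = avoids ∘ Containsℕ⇒Contains {T} {e} ∘ Containsᴹ⇒Containsℕ {T} c<a

  raiseVec lowerVec : Vec ℕ n → Vec ℕ n
  raiseVec e = tabulateℕ n (raise (lookupℕ e))
  lowerVec e = tabulateℕ n (lower (lookupℕ e))

  Raise-raiseVec : ∀ e → Raise (lookupℕ e) (lookupℕ (raiseVec e))
  Raise-raiseVec e k = lookupℕ-tabulateℕ n (raise (lookupℕ e))

  Lower-lowerVec : ∀ e → Lower (lookupℕ e) (lookupℕ (lowerVec e))
  Lower-lowerVec e k = lookupℕ-tabulateℕ n (lower (lookupℕ e))

  raiseVec-avoids₁ : ∀ {e} → IsInvSeq e × ¬ Pattern2 e → IsInvSeq (raiseVec e) × ¬ Pattern1 (raiseVec e)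
  raiseVec-avoids₁ {e} (inv , no₂) =
    IsInvSeqℕ⇒IsInvSeq {raiseVec e}
      (Raise-IsInvSeqℕ {lookupℕ e} (Raise-raiseVec e) (IsInvSeq⇒IsInvSeqℕ {e} inv)) ,
    Avoidsᴹ⇒Avoids Pat₁ {raiseVec e} Pat₁-upward
      (Raise-avoids₁ {lookupℕ e} (Avoids⇒Avoidsᴹ Pat₂ {e} (proj₂ ∘ proj₂) no₂) (Raise-raiseVec e))

  lowerVec-avoids₂ : ∀ {e} → IsInvSeq e × ¬ Pattern1 e → IsInvSeq (lowerVec e) × ¬ Pattern2 (lowerVec e)
  lowerVec-avoids₂ {e} (inv , no₁) =
    IsInvSeqℕ⇒IsInvSeq {lowerVec e}
      (Lower-IsInvSeqℕ {lookupℕ e} (Lower-lowerVec e) (IsInvSeq⇒IsInvSeqℕ {e} inv)) ,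
    Avoidsᴹ⇒Avoids Pat₂ {lowerVec e} Pat₂-upward
      (Lower-avoids₂ {lookupℕ e} (Avoids⇒Avoidsᴹ Pat₁ {e} proj₂ no₁) (Lower-lowerVec e))

  lowerVec∘raiseVec : ∀ {e} → IsInvSeq e × ¬ Pattern2 e → lowerVec (raiseVec e) ≡ e
  lowerVec∘raiseVec {e} (_ , no₂) = tabulateℕ-lookupℕ e (lower (lookupℕ (raiseVec e)))
    (Lower∘Raise {lookupℕ e} (Avoids⇒Avoidsᴹ Pat₂ {e} (proj₂ ∘ proj₂) no₂)
                 (Raise-raiseVec e) (λ _ _ → refl))

  raiseVec∘lowerVec : ∀ {e} → IsInvSeq e × ¬ Pattern1 e → raiseVec (lowerVec e) ≡ e
  raiseVec∘lowerVec {e} (_ , no₁) = tabulateℕ-lookupℕ e (raise (lookupℕ (lowerVec e)))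
    (Raise∘Lower {lookupℕ e} (Avoids⇒Avoidsᴹ Pat₁ {e} proj₂ no₁)
                 (Lower-lowerVec e) (λ _ _ → refl))

mainTheorem18 : (n : ℕ) → n ≥ 1 →
    (d₁ : (e : Vec ℕ n) → Dec (IsInvSeq e × ¬ Pattern1 e)) →
    (d₂ : (e : Vec ℕ n) → Dec (IsInvSeq e × ¬ Pattern2 e)) →
    count n d₁ ≡ count n d₂
mainTheorem18 n _ d₁ d₂ =
  length-filter-≡ d₁ d₂ (vecsBelow-unique n n) listed listed
    (raiseVec n) (lowerVec n) (λ {e} → raiseVec-avoids₁ n {e}) (λ {e} → lowerVec-avoids₂ n {e})
    (λ {e} → lowerVec∘raiseVec n {e}) (λ {e} → raiseVec∘lowerVec n {e})
  where
  listed : ∀ {A : Set} {e} → IsInvSeq e × A → e ∈ vecsBelow n n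
  listed {e = e} (inv , _) = ∈-vecsBelow e (IsInvSeq-bounded n {e} inv)
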